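{- For all integers $n\geq 2$ and $p\geq 1$, \[ [\phi_n,\phi_p]=-\frac{1}{n-1}\sum_{i=0}^{p}\binom{n-2+i}{n-2}\,b_i\,D_{\phi_{n-1+i}}(\phi_{p+1-i}) =-\sum_{i=0}^{p}\binom{n-1+i}{n-1}\frac{b_i}{n-1+i}\,D_{\phi_{n-1+i}}(\phi_{p+1-i}). \]
   Context: Let $\mathcal L$ be the free Lie algebra over $\mathbb Q$ on two generators $a,b$, with Lie bracket $[\cdot,\cdot]$, and let $\mathrm{ad}_a(x)=[a,x]$. For $n\geq 1$ set $\phi_n=\frac{1}{(n-1)!}\mathrm{ad}_a^{\,n-1}(b)$. For $f\in\mathcal L$, $D_f$ denotes the unique derivation of $\mathcal L$ with $D_f(a)=[f,a]$ and $D_f(b)=0$. The Bernoulli numbers $b_i$ are defined by $\frac{u}{e^u-1}=\sum_{i\geq0}b_i\frac{u^i}{i!}$. -}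

module Defs where

open import Data.Nat as ℕ using (ℕ; zero; suc; _∸_)
open import Data.Nat.Combinatorics using (_C_)
open import Data.Nat.Base using (_!)
open import Data.Nat.Properties using (_!≢0)
open import Data.Integer using (+_)
open import Data.Rational using (ℚ; _/_; _*_; -_; 0ℚ; 1ℚ)
import Data.Rational as ℚ
open import Data.Vec using (Vec; []; _∷_; lookup; _∷ʳ_)
open import Data.Fin using (Fin; fromℕ)
import Data.Fin as Fin

-- ℕ → ℚ embedding and the reciprocal 1/k (with the convention 1/0 = 0;
-- only ever used with k ≥ 1 in the statement).
ℕ→ℚ : ℕ → ℚ
ℕ→ℚ k = + k / 1

inv : ℕ → ℚ
inv zero    = 0ℚ
inv (suc k) = + 1 / suc k

-- Bernoulli numbers, convention u/(e^u - 1) = Σ b_i u^i / i!  (b₁ = -1/2).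
-- Comparing coefficients in (u/(e^u-1)) · ((e^u-1)/u) = 1 gives
--   b₀ = 1,  Σ_{k=0}^{m} C(m+1,k) b_k = 0  for m ≥ 1,
-- i.e.  b_m = -(1/(m+1)) Σ_{k<m} C(m+1,k) b_k.

private
  weighted : ∀ {m} → ℕ → Vec ℚ m → ℕ → ℚ
  weighted N []       k = 0ℚ
  weighted N (x ∷ xs) k = ℚ._+_ (ℕ→ℚ (N C k) * x) (weighted N xs (suc k))

bernoulliVec : (m : ℕ) → Vec ℚ (suc m)
bernoulliVec zero    = 1ℚ ∷ []
bernoulliVec (suc m) =
  let v = bernoulliVec m in
  v ∷ʳ (- (inv (suc (suc m)) * weighted (suc (suc m)) v 0))

bernoulli : ℕ → ℚ
bernoulli m = lookup (bernoulliVec m) (fromℕ m)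

-- The free Lie algebra over ℚ on two generators a, b, presented as the
-- free (nonassociative) ℚ-algebra on {a,b} (syntax trees) modulo the
-- congruence generated by the vector-space axioms, bilinearity of the
-- bracket, [x,x] = 0 and the Jacobi identity.

data Gen : Set where
  ga gb : Gen

infixl 6 _⊕_
infixr 7 _·_

data L : Set where
  gen  : Gen → L
  𝟘    : L
  _⊕_  : L → L → L
  _·_  : ℚ → L → L
  ⟦_,_⟧ : L → L → L

infix 4 _≈_

data _≈_ : L → L → Set where
  ≈-refl  : ∀ {x} → x ≈ x
  ≈-sym   : ∀ {x y} → x ≈ y → y ≈ x
  ≈-trans : ∀ {x y z} → x ≈ y → y ≈ z → x ≈ z
  ⊕-cong  : ∀ {x x' y y'} → x ≈ x' → y ≈ y' → x ⊕ y ≈ x' ⊕ y'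
  ·-cong  : ∀ {r x x'} → x ≈ x' → r · x ≈ r · x'
  br-cong : ∀ {x x' y y'} → x ≈ x' → y ≈ y' → ⟦ x , y ⟧ ≈ ⟦ x' , y' ⟧
  ⊕-assoc : ∀ x y z → (x ⊕ y) ⊕ z ≈ x ⊕ (y ⊕ z)
  ⊕-comm  : ∀ x y → x ⊕ y ≈ y ⊕ x
  ⊕-idʳ   : ∀ x → x ⊕ 𝟘 ≈ x
  ⊕-invʳ  : ∀ x → x ⊕ ((- 1ℚ) · x) ≈ 𝟘
  ·-assoc : ∀ r s x → (r * s) · x ≈ r · (s · x)
  ·-one   : ∀ x → 1ℚ · x ≈ x
  ·-distˡ : ∀ r x y → r · (x ⊕ y) ≈ r · x ⊕ r · y
  ·-distʳ : ∀ r s x → (ℚ._+_ r s) · x ≈ r · x ⊕ s · x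
  br-⊕ˡ   : ∀ x y z → ⟦ x ⊕ y , z ⟧ ≈ ⟦ x , z ⟧ ⊕ ⟦ y , z ⟧
  br-⊕ʳ   : ∀ x y z → ⟦ x , y ⊕ z ⟧ ≈ ⟦ x , y ⟧ ⊕ ⟦ x , z ⟧
  br-·ˡ   : ∀ r x y → ⟦ r · x , y ⟧ ≈ r · ⟦ x , y ⟧
  br-·ʳ   : ∀ r x y → ⟦ x , r · y ⟧ ≈ r · ⟦ x , y ⟧
  br-alt  : ∀ x → ⟦ x , x ⟧ ≈ 𝟘
  jacobi  : ∀ x y z → ⟦ x , ⟦ y , z ⟧ ⟧ ⊕ ⟦ y , ⟦ z , x ⟧ ⟧ ⊕ ⟦ z , ⟦ x , y ⟧ ⟧ ≈ 𝟘

a b : L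
a = gen ga
b = gen gb

⊖_ : L → L
⊖ x = (- 1ℚ) · x

adaPow : ℕ → L → L
adaPow zero    x = x
adaPow (suc k) x = ⟦ a , adaPow k x ⟧

-- φ_n = (1/(n-1)!) ad_a^{n-1}(b) for n ≥ 1  (φ 0 is an unused dummy value)
φ : ℕ → L
φ zero    = 𝟘
φ (suc k) = ((+ 1 / (k !)) {{k !≢0}}) · adaPow k b

D : L → L → L
D f (gen ga)  = ⟦ f , a ⟧
D f (gen gb)  = 𝟘
D f 𝟘         = 𝟘
D f (x ⊕ y)   = D f x ⊕ D f y
D f (r · x)   = r · D f x
D f ⟦ x , y ⟧ = ⟦ D f x , y ⟧ ⊕ ⟦ x , D f y ⟧

ΣL : ℕ → (ℕ → L) → L
ΣL zero    g = 𝟘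
ΣL (suc k) g = ΣL k g ⊕ g k

{-# OPTIONS --safe #-}
module Submission where

-- Write e_k = ad_a^k b, so that φ_{k+1} = e_k / k!.  Since D_f − ad_f vanishes on a, it commutes
-- with ad_a, hence D_f(e_v) = [f, e_v] − ad_a^v [f, b]; expanding ad_a^v [e_u, b] by the Leibniz
-- rule gives D_{e_u}(e_v) = − Σ_{j<v} C(v, j+1) [e_{u+j+1}, e_{v−j−1}].  Substituting this into the
-- right-hand side and collecting along the antidiagonals t = i + j, the coefficient of
-- [e_{n−1+t}, e_{p−1−t}] is a multiple of Σ_{i≤t} C(t+1, i) b_i, which vanishes for t ≥ 1 by the
-- recurrence defining the Bernoulli numbers, while the t = 0 term is [φ_n, φ_p].  The second form
-- follows termwise from the absorption identity (n−1) C(n−1+i, n−1) = (n−1+i) C(n−2+i, n−2).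

open import Defs
open import Data.Nat using (ℕ; _≤_; _+_; _∸_)
open import Data.Nat.Combinatorics using (_C_)
open import Data.Product using (_×_)
open import Data.Rational using (_*_; -_)

open import Algebra.Bundles using (AbelianGroup)
open import Data.Product using (_,_)
open import Data.Nat as ℕ using (zero; suc; _<_; z≤n; s≤s; NonZero; _!)
import Data.Nat.Properties as ℕ
open import Data.Nat.Combinatorics
  using (nCk≡n!/k![n-k]!; k![n∸k]!∣n!; nCk+nC[k+1]≡[n+1]C[k+1]; k>n⇒nCk≡0; nCk≡nC[n∸k]; nC1≡n)
open import Data.Nat.DivMod using (m/n*n≡m)
import Data.Nat.Solver
open import Data.Integer as ℤ using (+_)
import Data.Integer.Properties as ℤ
open import Data.Rational as ℚ using (ℚ; 0ℚ; 1ℚ; _/_; toℚᵘ)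
import Data.Rational.Properties as ℚ
open import Data.Rational.Solver using (module +-*-Solver)
open import Data.Rational.Unnormalised as ℚᵘ using (mkℚᵘ; *≡*)
import Data.Rational.Unnormalised.Properties as ℚᵘ
open import Data.Vec using (Vec; []; _∷_; lookup; _∷ʳ_)
open import Data.Fin using (fromℕ)
open import Relation.Binary.Bundles using (Setoid)
open import Relation.Binary.PropositionalEquality
  using (_≡_; refl; sym; trans; cong; cong₂; module ≡-Reasoning)

-- Binomial coefficients

binomial-factorial : ∀ k l → ((k + l) C k) ℕ.* (k ! ℕ.* l !) ≡ (k + l) !
binomial-factorial k l = begin
  ((k + l) C k) ℕ.* (k ! ℕ.* l !)              ≡⟨ cong (λ r → ((k + l) C k) ℕ.* (k ! ℕ.* r !)) (ℕ.m+n∸m≡n k l) ⟨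
  ((k + l) C k) ℕ.* (k ! ℕ.* (k + l ∸ k) !)    ≡⟨ cong (ℕ._* (k ! ℕ.* (k + l ∸ k) !)) (nCk≡n!/k![n-k]! k≤k+l) ⟩
  ((k + l) ! ℕ./ (k ! ℕ.* (k + l ∸ k) !)) ℕ.* (k ! ℕ.* (k + l ∸ k) !)
                                               ≡⟨ m/n*n≡m (k![n∸k]!∣n! k≤k+l) ⟩
  (k + l) !                                    ∎
  where
  open ≡-Reasoning
  instance _ = k ℕ.!* (k + l ∸ k) !≢0
  k≤k+l = ℕ.m≤m+n k l

binomial-absorption : ∀ k i → ((suc k + i) C suc k) ℕ.* suc k ≡ ((k + i) C k) ℕ.* suc (k + i)
binomial-absorption k i = ℕ.*-cancelʳ-≡ _ _ (k ! ℕ.* i !) {{k ℕ.!* i !≢0}} (begin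
  c′ ℕ.* suc k ℕ.* (k ! ℕ.* i !)      ≡⟨ solve 4 (λ c′ n f g → c′ :* n :* (f :* g) := c′ :* (n :* f :* g)) refl c′ (suc k) (k !) (i !) ⟩
  c′ ℕ.* (suc k ! ℕ.* i !)            ≡⟨ binomial-factorial (suc k) i ⟩
  suc (k + i) ℕ.* (k + i) !           ≡⟨ cong (suc (k + i) ℕ.*_) (binomial-factorial k i) ⟨
  suc (k + i) ℕ.* (c ℕ.* (k ! ℕ.* i !)) ≡⟨ solve 3 (λ n c f → n :* (c :* f) := c :* n :* f) refl (suc (k + i)) c (k ! ℕ.* i !) ⟩
  c ℕ.* suc (k + i) ℕ.* (k ! ℕ.* i !) ∎)
  where
  open ≡-Reasoning
  open Data.Nat.Solver.+-*-Solver
  c′ = (suc k + i) C suc k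
  c = (k + i) C k

[1+n]C[n]≡1+n : ∀ n → suc n C n ≡ suc n
[1+n]C[n]≡1+n n = begin
  suc n C n               ≡⟨ nCk≡nC[n∸k] (ℕ.n≤1+n n) ⟩
  suc n C (suc n ∸ n)     ≡⟨ cong (suc n C_) (ℕ.m+n∸n≡m 1 n) ⟩
  suc n C 1               ≡⟨ nC1≡n (suc n) ⟩
  suc n                   ∎
  where open ≡-Reasoning

1+m∸n≡1+[o∸n]+[m∸o] : ∀ {m n o} → n ≤ o → o ≤ m → suc m ∸ n ≡ suc (o ∸ n) + (m ∸ o)
1+m∸n≡1+[o∸n]+[m∸o] {m} {n} {o} n≤o o≤m = begin
  suc m ∸ n               ≡⟨ cong (λ k → suc k ∸ n) (ℕ.m+[n∸m]≡n o≤m) ⟨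
  suc o + (m ∸ o) ∸ n     ≡⟨ ℕ.+-∸-comm (m ∸ o) (ℕ.m≤n⇒m≤1+n n≤o) ⟩
  (suc o ∸ n) + (m ∸ o)   ≡⟨ cong (_+ (m ∸ o)) (ℕ.+-∸-assoc 1 n≤o) ⟩
  suc (o ∸ n) + (m ∸ o)   ∎
  where open ≡-Reasoning

invFact : ℕ → ℚ
invFact n = (+ 1 / n !) {{n ℕ.!≢0}}

/-cross : ∀ a b c d .{{_ : NonZero b}} .{{_ : NonZero d}} →
          a ℕ.* d ≡ c ℕ.* b → + a / b ≡ + c / d
/-cross a (suc b) c (suc d) ad≡cb = ℚ.fromℚᵘ-cong {mkℚᵘ (+ a) b} {mkℚᵘ (+ c) d} (*≡* (begin
  + a ℤ.* + suc d   ≡⟨ ℤ.pos-* a (suc d) ⟨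
  + (a ℕ.* suc d)   ≡⟨ cong +_ ad≡cb ⟩
  + (c ℕ.* suc b)   ≡⟨ ℤ.pos-* c (suc b) ⟩
  + c ℤ.* + suc b   ∎))
  where open ≡-Reasoning

/-*-/ : ∀ a b c d .{{_ : NonZero b}} .{{_ : NonZero d}} →
        (+ a / b) ℚ.* (+ c / d) ≡ (+ (a ℕ.* c) / (b ℕ.* d)) {{ℕ.m*n≢0 b d}}
/-*-/ a (suc b) c (suc d) = ℚ.toℚᵘ-injective (begin
  toℚᵘ ((+ a / suc b) ℚ.* (+ c / suc d))      ≈⟨ ℚ.toℚᵘ-homo-* (+ a / suc b) (+ c / suc d) ⟩
  toℚᵘ (+ a / suc b) ℚᵘ.* toℚᵘ (+ c / suc d)  ≈⟨ ℚᵘ.*-cong (ℚ.toℚᵘ-fromℚᵘ (mkℚᵘ (+ a) b)) (ℚ.toℚᵘ-fromℚᵘ (mkℚᵘ (+ c) d)) ⟩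
  mkℚᵘ (+ a) b ℚᵘ.* mkℚᵘ (+ c) d              ≈⟨ *≡* (cong (ℤ._* + (suc b ℕ.* suc d)) (sym (ℤ.pos-* a c))) ⟩
  mkℚᵘ (+ (a ℕ.* c)) (d ℕ.+ b ℕ.* suc d)      ≈⟨ ℚ.toℚᵘ-fromℚᵘ (mkℚᵘ (+ (a ℕ.* c)) (d ℕ.+ b ℕ.* suc d)) ⟨
  toℚᵘ (+ (a ℕ.* c) / (suc b ℕ.* suc d))      ∎)
  where open ℚᵘ.≃-Reasoning

ℕ→ℚ-+ : ∀ m n → ℕ→ℚ (m + n) ≡ ℕ→ℚ m ℚ.+ ℕ→ℚ n
ℕ→ℚ-+ m n = ℚ.toℚᵘ-injective (begin
  toℚᵘ (ℕ→ℚ (m + n))                ≈⟨ ℚ.toℚᵘ-fromℚᵘ (mkℚᵘ (+ (m + n)) 0) ⟩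
  mkℚᵘ (+ (m + n)) 0                ≈⟨ *≡* (cong (ℤ._* + 1) numerators) ⟩
  mkℚᵘ (+ m) 0 ℚᵘ.+ mkℚᵘ (+ n) 0    ≈⟨ ℚᵘ.+-cong (ℚ.toℚᵘ-fromℚᵘ (mkℚᵘ (+ m) 0)) (ℚ.toℚᵘ-fromℚᵘ (mkℚᵘ (+ n) 0)) ⟨
  toℚᵘ (ℕ→ℚ m) ℚᵘ.+ toℚᵘ (ℕ→ℚ n)    ≈⟨ ℚ.toℚᵘ-homo-+ (ℕ→ℚ m) (ℕ→ℚ n) ⟨
  toℚᵘ (ℕ→ℚ m ℚ.+ ℕ→ℚ n)            ∎)
  where
  open ℚᵘ.≃-Reasoning
  numerators : + (m + n) ≡ + m ℤ.* + 1 ℤ.+ + n ℤ.* + 1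
  numerators = trans (ℤ.pos-+ m n) (sym (cong₂ ℤ._+_ (ℤ.*-identityʳ (+ m)) (ℤ.*-identityʳ (+ n))))

pascal : ∀ k j → ℕ→ℚ (suc k C suc j) ≡ ℕ→ℚ (k C j) ℚ.+ ℕ→ℚ (k C suc j)
pascal k j = trans (cong ℕ→ℚ (sym (nCk+nC[k+1]≡[n+1]C[k+1] k j))) (ℕ→ℚ-+ (k C j) (k C suc j))

binomial-invFact : ∀ {n} k l → n ≡ k + l → ℕ→ℚ (n C k) ℚ.* invFact n ≡ invFact k ℚ.* invFact l
binomial-invFact k l refl =
  trans (/-*-/ c 1 1 ((k + l) !) {{_}} {{(k + l) ℕ.!≢0}})
  (trans (/-cross (c ℕ.* 1) (1 ℕ.* (k + l) !) (1 ℕ.* 1) (k ! ℕ.* l !)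
                  {{ℕ.m*n≢0 1 ((k + l) !) {{_}} {{(k + l) ℕ.!≢0}}}} {{k ℕ.!* l !≢0}} cross)
  (sym (/-*-/ 1 (k !) 1 (l !) {{k ℕ.!≢0}} {{l ℕ.!≢0}})))
  where
  c = (k + l) C k
  cross : c ℕ.* 1 ℕ.* (k ! ℕ.* l !) ≡ 1 ℕ.* 1 ℕ.* (1 ℕ.* (k + l) !)
  cross = trans (cong (ℕ._* (k ! ℕ.* l !)) (ℕ.*-identityʳ c))
                (trans (binomial-factorial k l) (sym (trans (ℕ.*-identityˡ _) (ℕ.*-identityˡ _))))

ℕ→ℚ*inv : ∀ a b → ℕ→ℚ a ℚ.* inv (suc b) ≡ + a / suc b
ℕ→ℚ*inv a b = trans (/-*-/ a 1 1 (suc b)) (/-cross (a ℕ.* 1) (1 ℕ.* suc b) a (suc b) cross)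
  where
  cross : a ℕ.* 1 ℕ.* suc b ≡ a ℕ.* (1 ℕ.* suc b)
  cross = cong₂ ℕ._*_ (ℕ.*-identityʳ a) (sym (ℕ.*-identityˡ (suc b)))

ℕ→ℚ[1+n]*inv[1+n]≡1 : ∀ n → ℕ→ℚ (suc n) ℚ.* inv (suc n) ≡ 1ℚ
ℕ→ℚ[1+n]*inv[1+n]≡1 n = trans (ℕ→ℚ*inv (suc n) n) (/-cross (suc n) (suc n) 1 1 (ℕ.*-comm (suc n) 1))

inv*invFact : ∀ n → inv (suc n) ℚ.* invFact n ≡ invFact (suc n)
inv*invFact n = /-*-/ 1 (suc n) 1 (n !) {{_}} {{n ℕ.!≢0}}

binomial-absorption-ℚ : ∀ k i → ℕ→ℚ ((suc k + i) C suc k) ℚ.* inv (suc k + i) ≡ inv (suc k) ℚ.* ℕ→ℚ ((k + i) C k)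
binomial-absorption-ℚ k i = begin
  ℕ→ℚ c′ ℚ.* inv (suc k + i)  ≡⟨ ℕ→ℚ*inv c′ (k + i) ⟩
  + c′ / suc (k + i)           ≡⟨ /-cross c′ (suc (k + i)) c (suc k) (binomial-absorption k i) ⟩
  + c / suc k                  ≡⟨ ℕ→ℚ*inv c k ⟨
  ℕ→ℚ c ℚ.* inv (suc k)        ≡⟨ ℚ.*-comm (ℕ→ℚ c) (inv (suc k)) ⟩
  inv (suc k) ℚ.* ℕ→ℚ c        ∎
  where
  open ≡-Reasoning
  c′ = (suc k + i) C suc k
  c = (k + i) C k

-- Bernoulli numbers

Σℚ : ℕ → (ℕ → ℚ) → ℚ
Σℚ zero    f = 0ℚ
Σℚ (suc k) f = Σℚ k f ℚ.+ f k

Σℚ-*ˡ : ∀ k r (f : ℕ → ℚ) → Σℚ k (λ i → r ℚ.* f i) ≡ r ℚ.* Σℚ k f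
Σℚ-*ˡ zero    r f = sym (ℚ.*-zeroʳ r)
Σℚ-*ˡ (suc k) r f = trans (cong (ℚ._+ r ℚ.* f k) (Σℚ-*ˡ k r f)) (sym (ℚ.*-distribˡ-+ r (Σℚ k f) (f k)))

weightedSum : ∀ {m} → ℕ → Vec ℚ m → ℕ → ℚ
weightedSum N []       k = 0ℚ
weightedSum N (x ∷ xs) k = ℕ→ℚ (N C k) ℚ.* x ℚ.+ weightedSum N xs (suc k)

weightedSum-∷ʳ : ∀ {n} N (v : Vec ℚ n) x k →
                 weightedSum N (v ∷ʳ x) k ≡ weightedSum N v k ℚ.+ ℕ→ℚ (N C (k + n)) ℚ.* x
weightedSum-∷ʳ N []       x k = begin
  ℕ→ℚ (N C k) ℚ.* x ℚ.+ 0ℚ      ≡⟨ ℚ.+-comm (ℕ→ℚ (N C k) ℚ.* x) 0ℚ ⟩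
  0ℚ ℚ.+ ℕ→ℚ (N C k) ℚ.* x      ≡⟨ cong (λ j → 0ℚ ℚ.+ ℕ→ℚ (N C j) ℚ.* x) (ℕ.+-identityʳ k) ⟨
  0ℚ ℚ.+ ℕ→ℚ (N C (k + 0)) ℚ.* x ∎
  where open ≡-Reasoning
weightedSum-∷ʳ {suc n} N (y ∷ v) x k = begin
  ℕ→ℚ (N C k) ℚ.* y ℚ.+ weightedSum N (v ∷ʳ x) (suc k)
    ≡⟨ cong (ℕ→ℚ (N C k) ℚ.* y ℚ.+_) (weightedSum-∷ʳ N v x (suc k)) ⟩
  ℕ→ℚ (N C k) ℚ.* y ℚ.+ (weightedSum N v (suc k) ℚ.+ ℕ→ℚ (N C (suc k + n)) ℚ.* x)
    ≡⟨ ℚ.+-assoc (ℕ→ℚ (N C k) ℚ.* y) (weightedSum N v (suc k)) _ ⟨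
  ℕ→ℚ (N C k) ℚ.* y ℚ.+ weightedSum N v (suc k) ℚ.+ ℕ→ℚ (N C (suc k + n)) ℚ.* x
    ≡⟨ cong (λ j → weightedSum N (y ∷ v) k ℚ.+ ℕ→ℚ (N C j) ℚ.* x) (ℕ.+-suc k n) ⟨
  weightedSum N (y ∷ v) k ℚ.+ ℕ→ℚ (N C (k + suc n)) ℚ.* x
    ∎
  where open ≡-Reasoning

-- `weighted` is private to Defs, so its unfolding cannot be stated directly: `≗weightedSum`
-- holds for every F obeying its defining equations, and the unifier instantiates F to `weighted`
-- once `with` has generalised the arguments.
private
  lookup-∷ʳ-last : ∀ {n} (v : Vec ℚ n) x → lookup (v ∷ʳ x) (fromℕ n) ≡ x
  lookup-∷ʳ-last []      x = refl
  lookup-∷ʳ-last (y ∷ v) x = lookup-∷ʳ-last v x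

  module _ (F : ∀ {m} → ℕ → Vec ℚ m → ℕ → ℚ)
           (F-[] : ∀ N k → F N [] k ≡ 0ℚ)
           (F-∷ : ∀ {m} N x (xs : Vec ℚ m) k → F N (x ∷ xs) k ≡ ℕ→ℚ (N C k) ℚ.* x ℚ.+ F N xs (suc k)) where
    ≗weightedSum : ∀ {m} N (v : Vec ℚ m) k → F N v k ≡ weightedSum N v k
    ≗weightedSum N []       k = F-[] N k
    ≗weightedSum N (x ∷ xs) k = trans (F-∷ N x xs k) (cong (ℕ→ℚ (N C k) ℚ.* x ℚ.+_) (≗weightedSum N xs (suc k)))

mutual
  bernoulli-suc : ∀ m → bernoulli (suc m) ≡ - (inv (suc (suc m)) ℚ.* weightedSum (suc (suc m)) (bernoulliVec m) 0)
  bernoulli-suc m = trans (lookup-∷ʳ-last (bernoulliVec m) _) (cong (λ z → - (inv (suc (suc m)) ℚ.* z)) (unfold-weighted m))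

  unfold-weighted : ∀ m → _ ≡ weightedSum (suc (suc m)) (bernoulliVec m) 0
  unfold-weighted m with ≗weightedSum _ (λ _ _ → refl) (λ _ _ _ _ → refl)
  ... | unfold with suc m | suc (suc m) | bernoulliVec m | 0
  ... | _ | N | v | k = unfold N v k

weightedSum-bernoulliVec : ∀ m N → weightedSum N (bernoulliVec m) 0 ≡ Σℚ (suc m) (λ i → ℕ→ℚ (N C i) ℚ.* bernoulli i)
weightedSum-bernoulliVec zero    N = ℚ.+-comm (ℕ→ℚ (N C 0) ℚ.* 1ℚ) 0ℚ
weightedSum-bernoulliVec (suc m) N = trans (weightedSum-∷ʳ N (bernoulliVec m) _ 0)
  (cong₂ ℚ._+_ (weightedSum-bernoulliVec m N) (cong (ℕ→ℚ (N C suc m) ℚ.*_) (sym (lookup-∷ʳ-last (bernoulliVec m) _))))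

bernoulli-recurrence : ∀ m → Σℚ (suc (suc m)) (λ i → ℕ→ℚ (suc (suc m) C i) ℚ.* bernoulli i) ≡ 0ℚ
bernoulli-recurrence m = begin
  S ℚ.+ ℕ→ℚ (suc (suc m) C suc m) ℚ.* bernoulli (suc m)
    ≡⟨ cong₂ (λ c b → S ℚ.+ ℕ→ℚ c ℚ.* b) ([1+n]C[n]≡1+n (suc m))
             (trans (bernoulli-suc m) (cong (λ z → - (ι ℚ.* z)) (weightedSum-bernoulliVec m (suc (suc m))))) ⟩
  S ℚ.+ α ℚ.* (- (ι ℚ.* S))   ≡⟨ solve 3 (λ S α ι → S :+ α :* (:- (ι :* S)) := S :* (con 1ℚ :- α :* ι)) refl S α ι ⟩
  S ℚ.* (1ℚ ℚ.- α ℚ.* ι)      ≡⟨ cong (λ z → S ℚ.* (1ℚ ℚ.- z)) (ℕ→ℚ[1+n]*inv[1+n]≡1 (suc m)) ⟩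
  S ℚ.* (1ℚ ℚ.- 1ℚ)           ≡⟨ ℚ.*-zeroʳ S ⟩
  0ℚ                          ∎
  where
  open ≡-Reasoning
  open +-*-Solver
  S = Σℚ (suc m) (λ i → ℕ→ℚ (suc (suc m) C i) ℚ.* bernoulli i)
  α = ℕ→ℚ (suc (suc m))
  ι = inv (suc (suc m))

-- Both sides equal β / ((M + 1) · M! · i! · (j + 1)! · r!).
antidiagonal-coefficient : ∀ M i j r β →
  (- inv (suc M)) ℚ.* ((ℕ→ℚ ((M + i) C M) ℚ.* β) ℚ.* (invFact (suc j + r) ℚ.* (invFact (M + i) ℚ.* (- 1ℚ ℚ.* ℕ→ℚ ((suc j + r) C suc j)))))
  ≡ (inv (suc M) ℚ.* (invFact M ℚ.* (invFact r ℚ.* invFact (suc (i + j))))) ℚ.* (ℕ→ℚ (suc (i + j) C i) ℚ.* β)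
antidiagonal-coefficient M i j r β = begin
  (- ι) ℚ.* ((c₁ ℚ.* β) ℚ.* (f₂ ℚ.* (f₁ ℚ.* (- 1ℚ ℚ.* c₂))))
    ≡⟨ solve 6 (λ ι c₁ β f₂ f₁ c₂ → (:- ι) :* ((c₁ :* β) :* (f₂ :* (f₁ :* ((:- con 1ℚ) :* c₂))))
                                   := ι :* (c₁ :* f₁) :* (c₂ :* f₂) :* β) refl ι c₁ β f₂ f₁ c₂ ⟩
  ι ℚ.* (c₁ ℚ.* f₁) ℚ.* (c₂ ℚ.* f₂) ℚ.* β
    ≡⟨ cong₂ (λ x y → ι ℚ.* x ℚ.* y ℚ.* β) (binomial-invFact M i refl) (binomial-invFact (suc j) r refl) ⟩
  ι ℚ.* (invFact M ℚ.* invFact i) ℚ.* (invFact (suc j) ℚ.* invFact r) ℚ.* β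
    ≡⟨ solve 6 (λ ι g h k l β → ι :* (g :* h) :* (k :* l) :* β := ι :* g :* l :* (h :* k) :* β)
             refl ι (invFact M) (invFact i) (invFact (suc j)) (invFact r) β ⟩
  ι ℚ.* invFact M ℚ.* invFact r ℚ.* (invFact i ℚ.* invFact (suc j)) ℚ.* β
    ≡⟨ cong (λ x → ι ℚ.* invFact M ℚ.* invFact r ℚ.* x ℚ.* β) (binomial-invFact i (suc j) (sym (ℕ.+-suc i j))) ⟨
  ι ℚ.* invFact M ℚ.* invFact r ℚ.* (c₃ ℚ.* f₃) ℚ.* β
    ≡⟨ solve 6 (λ ι g l c₃ f₃ β → ι :* g :* l :* (c₃ :* f₃) :* β := (ι :* (g :* (l :* f₃))) :* (c₃ :* β))
             refl ι (invFact M) (invFact r) c₃ f₃ β ⟩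
  (ι ℚ.* (invFact M ℚ.* (invFact r ℚ.* f₃))) ℚ.* (c₃ ℚ.* β)
    ∎
  where
  open ≡-Reasoning
  open +-*-Solver
  ι = inv (suc M)
  c₁ = ℕ→ℚ ((M + i) C M)
  c₂ = ℕ→ℚ ((suc j + r) C suc j)
  c₃ = ℕ→ℚ (suc (i + j) C i)
  f₁ = invFact (M + i)
  f₂ = invFact (suc j + r)
  f₃ = invFact (suc (i + j))

leading-coefficient : ∀ M P → inv (suc M) ℚ.* (invFact M ℚ.* (invFact P ℚ.* invFact 1)) ≡ invFact (suc M) ℚ.* invFact P
leading-coefficient M P = begin
  inv (suc M) ℚ.* (invFact M ℚ.* (invFact P ℚ.* 1ℚ))  ≡⟨ cong (λ x → inv (suc M) ℚ.* (invFact M ℚ.* x)) (ℚ.*-identityʳ (invFact P)) ⟩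
  inv (suc M) ℚ.* (invFact M ℚ.* invFact P)           ≡⟨ ℚ.*-assoc (inv (suc M)) (invFact M) (invFact P) ⟨
  inv (suc M) ℚ.* invFact M ℚ.* invFact P             ≡⟨ cong (ℚ._* invFact P) (inv*invFact M) ⟩
  invFact (suc M) ℚ.* invFact P                       ∎
  where open ≡-Reasoning

absorbed-coefficient : ∀ M i β →
  - 1ℚ ℚ.* (ℕ→ℚ ((suc M + i) C suc M) ℚ.* (β ℚ.* inv (suc M + i))) ≡ (- inv (suc M)) ℚ.* (ℕ→ℚ ((M + i) C M) ℚ.* β)
absorbed-coefficient M i β = begin
  - 1ℚ ℚ.* (c′ ℚ.* (β ℚ.* ι′))  ≡⟨ solve 3 (λ c′ β ι′ → (:- con 1ℚ) :* (c′ :* (β :* ι′)) := :- ((c′ :* ι′) :* β)) refl c′ β ι′ ⟩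
  - ((c′ ℚ.* ι′) ℚ.* β)         ≡⟨ cong (λ x → - (x ℚ.* β)) (binomial-absorption-ℚ M i) ⟩
  - ((ι ℚ.* c) ℚ.* β)           ≡⟨ solve 3 (λ ι c β → :- ((ι :* c) :* β) := (:- ι) :* (c :* β)) refl ι c β ⟩
  (- ι) ℚ.* (c ℚ.* β)           ∎
  where
  open ≡-Reasoning
  open +-*-Solver
  c′ = ℕ→ℚ ((suc M + i) C suc M)
  c = ℕ→ℚ ((M + i) C M)
  ι′ = inv (suc M + i)
  ι = inv (suc M)

-- The free Lie algebra

L-setoid : Setoid _ _
L-setoid = record { Carrier = L ; _≈_ = _≈_ ; isEquivalence = record { refl = ≈-refl ; sym = ≈-sym ; trans = ≈-trans } }

L-abelianGroup : AbelianGroup _ _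
L-abelianGroup = record
  { Carrier = L ; _≈_ = _≈_ ; _∙_ = _⊕_ ; ε = 𝟘 ; _⁻¹ = ⊖_
  ; isAbelianGroup = record
    { isGroup = record
      { isMonoid = record
        { isSemigroup = record
          { isMagma = record { isEquivalence = Setoid.isEquivalence L-setoid ; ∙-cong = ⊕-cong }
          ; assoc = ⊕-assoc }
        ; identity = (λ x → ≈-trans (⊕-comm 𝟘 x) (⊕-idʳ x)) , ⊕-idʳ }
      ; inverse = (λ x → ≈-trans (⊕-comm (⊖ x) x) (⊕-invʳ x)) , ⊕-invʳ
      ; ⁻¹-cong = ·-cong }
    ; comm = ⊕-comm } }

open AbelianGroup L-abelianGroup using (identityˡ)
open import Algebra.Properties.AbelianGroup L-abelianGroup using (∙-cancelˡ; inverseˡ-unique; inverseʳ-unique)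
open import Algebra.Properties.CommutativeSemigroup (AbelianGroup.commutativeSemigroup L-abelianGroup) using (interchange; x∙yz≈y∙xz)
open import Relation.Binary.Reasoning.Setoid L-setoid

≡⇒≈ : ∀ {x y} → x ≡ y → x ≈ y
≡⇒≈ = Setoid.reflexive L-setoid

·-zeroˡ : ∀ x → 0ℚ · x ≈ 𝟘
·-zeroˡ x = ∙-cancelˡ (0ℚ · x) (0ℚ · x) 𝟘 (begin
  0ℚ · x ⊕ 0ℚ · x   ≈⟨ ·-distʳ 0ℚ 0ℚ x ⟨
  (0ℚ ℚ.+ 0ℚ) · x   ≡⟨⟩
  0ℚ · x            ≈⟨ ⊕-idʳ (0ℚ · x) ⟨
  0ℚ · x ⊕ 𝟘        ∎)

·-zeroʳ : ∀ r → r · 𝟘 ≈ 𝟘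
·-zeroʳ r = begin
  r · 𝟘           ≈⟨ ·-cong (·-zeroˡ 𝟘) ⟨
  r · (0ℚ · 𝟘)    ≈⟨ ·-assoc r 0ℚ 𝟘 ⟨
  (r ℚ.* 0ℚ) · 𝟘  ≡⟨ cong (_· 𝟘) (ℚ.*-zeroʳ r) ⟩
  0ℚ · 𝟘          ≈⟨ ·-zeroˡ 𝟘 ⟩
  𝟘               ∎

·-congʳ : ∀ {r s} x → r ≡ s → r · x ≈ s · x
·-congʳ x refl = ≈-refl

br-zeroʳ : ∀ x → ⟦ x , 𝟘 ⟧ ≈ 𝟘
br-zeroʳ x = begin
  ⟦ x , 𝟘 ⟧        ≈⟨ br-cong ≈-refl (·-zeroˡ 𝟘) ⟨
  ⟦ x , 0ℚ · 𝟘 ⟧   ≈⟨ br-·ʳ 0ℚ x 𝟘 ⟩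
  0ℚ · ⟦ x , 𝟘 ⟧   ≈⟨ ·-zeroˡ _ ⟩
  𝟘                ∎

br-·-· : ∀ r s x y → ⟦ r · x , s · y ⟧ ≈ (r ℚ.* s) · ⟦ x , y ⟧
br-·-· r s x y = begin
  ⟦ r · x , s · y ⟧    ≈⟨ br-·ˡ r x (s · y) ⟩
  r · ⟦ x , s · y ⟧    ≈⟨ ·-cong (br-·ʳ s x y) ⟩
  r · (s · ⟦ x , y ⟧)  ≈⟨ ·-assoc r s _ ⟨
  (r ℚ.* s) · ⟦ x , y ⟧ ∎

br-antisym : ∀ x y → ⟦ x , y ⟧ ≈ ⊖ ⟦ y , x ⟧
br-antisym x y = inverseʳ-unique ⟦ y , x ⟧ ⟦ x , y ⟧ (begin
  ⟦ y , x ⟧ ⊕ ⟦ x , y ⟧                              ≈⟨ ⊕-cong (identityˡ _) (⊕-idʳ _) ⟨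
  (𝟘 ⊕ ⟦ y , x ⟧) ⊕ (⟦ x , y ⟧ ⊕ 𝟘)                  ≈⟨ ⊕-cong (⊕-cong (br-alt x) ≈-refl) (⊕-cong ≈-refl (br-alt y)) ⟨
  (⟦ x , x ⟧ ⊕ ⟦ y , x ⟧) ⊕ (⟦ x , y ⟧ ⊕ ⟦ y , y ⟧)  ≈⟨ ⊕-cong (br-⊕ˡ x y x) (br-⊕ˡ x y y) ⟨
  ⟦ x ⊕ y , x ⟧ ⊕ ⟦ x ⊕ y , y ⟧                      ≈⟨ br-⊕ʳ (x ⊕ y) x y ⟨
  ⟦ x ⊕ y , x ⊕ y ⟧                                  ≈⟨ br-alt (x ⊕ y) ⟩
  𝟘                                                  ∎)

br-leibniz : ∀ z x y → ⟦ z , ⟦ x , y ⟧ ⟧ ≈ ⟦ ⟦ z , x ⟧ , y ⟧ ⊕ ⟦ x , ⟦ z , y ⟧ ⟧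
br-leibniz z x y = begin
  ⟦ z , ⟦ x , y ⟧ ⟧                            ≈⟨ inverseˡ-unique _ _ (≈-trans (≈-sym (⊕-assoc _ _ _)) (jacobi z x y)) ⟩
  ⊖ (⟦ x , ⟦ y , z ⟧ ⟧ ⊕ ⟦ y , ⟦ z , x ⟧ ⟧)    ≈⟨ ·-distˡ _ _ _ ⟩
  ⊖ ⟦ x , ⟦ y , z ⟧ ⟧ ⊕ ⊖ ⟦ y , ⟦ z , x ⟧ ⟧    ≈⟨ ⊕-comm _ _ ⟩
  ⊖ ⟦ y , ⟦ z , x ⟧ ⟧ ⊕ ⊖ ⟦ x , ⟦ y , z ⟧ ⟧    ≈⟨ ⊕-cong (br-antisym ⟦ z , x ⟧ y) (br-·ʳ _ x _) ⟨
  ⟦ ⟦ z , x ⟧ , y ⟧ ⊕ ⟦ x , ⊖ ⟦ y , z ⟧ ⟧      ≈⟨ ⊕-cong ≈-refl (br-cong ≈-refl (br-antisym z y)) ⟨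
  ⟦ ⟦ z , x ⟧ , y ⟧ ⊕ ⟦ x , ⟦ z , y ⟧ ⟧        ∎

ΣL-cong : ∀ k {g h} → (∀ i → i < k → g i ≈ h i) → ΣL k g ≈ ΣL k h
ΣL-cong zero    g≈h = ≈-refl
ΣL-cong (suc k) g≈h = ⊕-cong (ΣL-cong k (λ i i<k → g≈h i (ℕ.m<n⇒m<1+n i<k))) (g≈h k ℕ.≤-refl)

ΣL-zero : ∀ k {g} → (∀ i → i < k → g i ≈ 𝟘) → ΣL k g ≈ 𝟘
ΣL-zero zero    g≈𝟘 = ≈-refl
ΣL-zero (suc k) g≈𝟘 = ≈-trans (⊕-cong (ΣL-zero k (λ i i<k → g≈𝟘 i (ℕ.m<n⇒m<1+n i<k))) (g≈𝟘 k ℕ.≤-refl)) (⊕-idʳ 𝟘)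

ΣL-⊕ : ∀ k g h → ΣL k (λ i → g i ⊕ h i) ≈ ΣL k g ⊕ ΣL k h
ΣL-⊕ zero    g h = ≈-sym (⊕-idʳ 𝟘)
ΣL-⊕ (suc k) g h = ≈-trans (⊕-cong (ΣL-⊕ k g h) ≈-refl) (interchange _ _ _ _)

·-ΣL : ∀ k r g → r · ΣL k g ≈ ΣL k (λ i → r · g i)
·-ΣL zero    r g = ·-zeroʳ r
·-ΣL (suc k) r g = ≈-trans (·-distˡ r _ _) (⊕-cong (·-ΣL k r g) ≈-refl)

·-ΣL-· : ∀ k r (s : ℕ → ℚ) (X : ℕ → L) → r · ΣL k (λ i → s i · X i) ≈ ΣL k (λ i → (r ℚ.* s i) · X i)
·-ΣL-· k r s X = ≈-trans (·-ΣL k r _) (ΣL-cong k (λ i _ → ≈-sym (·-assoc r (s i) (X i))))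

ΣL-·ˡ : ∀ k f x → ΣL k (λ i → f i · x) ≈ Σℚ k f · x
ΣL-·ˡ zero    f x = ≈-sym (·-zeroˡ x)
ΣL-·ˡ (suc k) f x = ≈-trans (⊕-cong (ΣL-·ˡ k f x) ≈-refl) (≈-sym (·-distʳ _ _ x))

ΣL-brʳ : ∀ k x g → ⟦ x , ΣL k g ⟧ ≈ ΣL k (λ i → ⟦ x , g i ⟧)
ΣL-brʳ zero    x g = br-zeroʳ x
ΣL-brʳ (suc k) x g = ≈-trans (br-⊕ʳ x _ _) (⊕-cong (ΣL-brʳ k x g) ≈-refl)

ΣL-first : ∀ k g → ΣL (suc k) g ≈ g 0 ⊕ ΣL k (λ i → g (suc i))
ΣL-first zero    g = ≈-trans (identityˡ (g 0)) (≈-sym (⊕-idʳ (g 0)))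
ΣL-first (suc k) g = ≈-trans (⊕-cong (ΣL-first k g) ≈-refl) (⊕-assoc _ _ _)

ΣL-triangle : ∀ p (G : ℕ → ℕ → L) →
              ΣL (suc p) (λ i → ΣL (p ∸ i) (G i)) ≈ ΣL p (λ t → ΣL (suc t) (λ i → G i (t ∸ i)))
ΣL-triangle zero    G = ⊕-idʳ 𝟘
ΣL-triangle (suc q) G = begin
  ΣL (suc q) (λ i → ΣL (suc q ∸ i) (G i)) ⊕ ΣL (q ∸ q) (G (suc q))
    ≡⟨ cong (λ k → ΣL (suc q) (λ i → ΣL (suc q ∸ i) (G i)) ⊕ ΣL k (G (suc q))) (ℕ.n∸n≡0 q) ⟩
  ΣL (suc q) (λ i → ΣL (suc q ∸ i) (G i)) ⊕ 𝟘
    ≈⟨ ⊕-idʳ _ ⟩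
  ΣL (suc q) (λ i → ΣL (suc q ∸ i) (G i))
    ≈⟨ ΣL-cong (suc q) (λ i i<1+q → ≡⇒≈ (cong (λ k → ΣL k (G i)) (ℕ.+-∸-assoc 1 (ℕ.≤-pred i<1+q)))) ⟩
  ΣL (suc q) (λ i → ΣL (q ∸ i) (G i) ⊕ G i (q ∸ i))
    ≈⟨ ΣL-⊕ (suc q) _ _ ⟩
  ΣL (suc q) (λ i → ΣL (q ∸ i) (G i)) ⊕ ΣL (suc q) (λ i → G i (q ∸ i))
    ≈⟨ ⊕-cong (ΣL-triangle q G) ≈-refl ⟩
  ΣL (suc q) (λ t → ΣL (suc t) (λ i → G i (t ∸ i)))
    ∎

pascal-sum : ∀ k (f : ℕ → ℕ → L) →
  ΣL (suc k) (λ j → ℕ→ℚ (k C j) · (f (suc j) (k ∸ j) ⊕ f j (suc (k ∸ j))))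
  ≈ ΣL (suc (suc k)) (λ j → ℕ→ℚ (suc k C j) · f j (suc k ∸ j))
pascal-sum k f = begin
  ΣL (suc k) (λ j → c j · (A j ⊕ f j (suc (k ∸ j))))
    ≈⟨ ΣL-cong (suc k) (λ j _ → ·-distˡ (c j) _ _) ⟩
  ΣL (suc k) (λ j → c j · A j ⊕ c j · f j (suc (k ∸ j)))
    ≈⟨ ΣL-⊕ (suc k) _ _ ⟩
  ΣL (suc k) (λ j → c j · A j) ⊕ ΣL (suc k) (λ j → c j · f j (suc (k ∸ j)))
    ≈⟨ ⊕-cong ≈-refl shifted ⟩
  ΣL (suc k) (λ j → c j · A j) ⊕ (f 0 (suc k) ⊕ ΣL (suc k) (λ j → c (suc j) · A j))
    ≈⟨ x∙yz≈y∙xz _ _ _ ⟩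
  f 0 (suc k) ⊕ (ΣL (suc k) (λ j → c j · A j) ⊕ ΣL (suc k) (λ j → c (suc j) · A j))
    ≈⟨ ⊕-cong ≈-refl (ΣL-⊕ (suc k) _ _) ⟨
  f 0 (suc k) ⊕ ΣL (suc k) (λ j → c j · A j ⊕ c (suc j) · A j)
    ≈⟨ ⊕-cong (·-one _) (ΣL-cong (suc k) (λ j _ → ≈-trans (·-congʳ _ (pascal k j)) (·-distʳ _ _ _))) ⟨
  ℕ→ℚ (suc k C 0) · f 0 (suc k) ⊕ ΣL (suc k) (λ j → ℕ→ℚ (suc k C suc j) · A j)
    ≈⟨ ΣL-first (suc k) _ ⟨
  ΣL (suc (suc k)) (λ j → ℕ→ℚ (suc k C j) · f j (suc k ∸ j))
    ∎
  where
  c : ℕ → ℚ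
  c j = ℕ→ℚ (k C j)
  A : ℕ → L
  A j = f (suc j) (k ∸ j)
  shifted : ΣL (suc k) (λ j → c j · f j (suc (k ∸ j))) ≈ f 0 (suc k) ⊕ ΣL (suc k) (λ j → c (suc j) · A j)
  shifted = begin
    ΣL (suc k) (λ j → c j · f j (suc (k ∸ j)))
      ≈⟨ ΣL-first k _ ⟩
    c 0 · f 0 (suc k) ⊕ ΣL k (λ j → c (suc j) · f (suc j) (suc (k ∸ suc j)))
      ≈⟨ ⊕-cong (·-one _) (ΣL-cong k (λ j j<k → ≡⇒≈ (cong (λ l → c (suc j) · f (suc j) l) (sym (ℕ.+-∸-assoc 1 j<k))))) ⟩
    f 0 (suc k) ⊕ ΣL k (λ j → c (suc j) · A j)
      ≈⟨ ⊕-cong ≈-refl (⊕-idʳ _) ⟨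
    f 0 (suc k) ⊕ (ΣL k (λ j → c (suc j) · A j) ⊕ 𝟘)
      ≈⟨ ⊕-cong ≈-refl (⊕-cong ≈-refl (≈-trans (·-congʳ _ (cong ℕ→ℚ (k>n⇒nCk≡0 (ℕ.n<1+n k)))) (·-zeroˡ _))) ⟨
    f 0 (suc k) ⊕ ΣL (suc k) (λ j → c (suc j) · A j)
      ∎

-- Powers of ad_a and the derivations D_f

adaPow-+ : ∀ j k x → adaPow j (adaPow k x) ≡ adaPow (j + k) x
adaPow-+ zero    k x = refl
adaPow-+ (suc j) k x = cong ⟦ a ,_⟧ (adaPow-+ j k x)

adaPow-br : ∀ k x y → adaPow k ⟦ x , y ⟧ ≈ ΣL (suc k) (λ j → ℕ→ℚ (k C j) · ⟦ adaPow j x , adaPow (k ∸ j) y ⟧)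
adaPow-br zero    x y = ≈-trans (≈-sym (·-one _)) (≈-sym (identityˡ _))
adaPow-br (suc k) x y = begin
  ⟦ a , adaPow k ⟦ x , y ⟧ ⟧
    ≈⟨ br-cong ≈-refl (adaPow-br k x y) ⟩
  ⟦ a , ΣL (suc k) (λ j → ℕ→ℚ (k C j) · T j (k ∸ j)) ⟧
    ≈⟨ ΣL-brʳ (suc k) a _ ⟩
  ΣL (suc k) (λ j → ⟦ a , ℕ→ℚ (k C j) · T j (k ∸ j) ⟧)
    ≈⟨ ΣL-cong (suc k) (λ j _ → ≈-trans (br-·ʳ _ a _) (·-cong (br-leibniz a _ _))) ⟩
  ΣL (suc k) (λ j → ℕ→ℚ (k C j) · (T (suc j) (k ∸ j) ⊕ T j (suc (k ∸ j))))
    ≈⟨ pascal-sum k T ⟩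
  ΣL (suc (suc k)) (λ j → ℕ→ℚ (suc k C j) · T j (suc k ∸ j))
    ∎
  where
  T : ℕ → ℕ → L
  T i l = ⟦ adaPow i x , adaPow l y ⟧

D-·ˡ : ∀ r f y → D (r · f) y ≈ r · D f y
D-·ˡ r f (gen ga)  = br-·ˡ r f a
D-·ˡ r f (gen gb)  = ≈-sym (·-zeroʳ r)
D-·ˡ r f 𝟘         = ≈-sym (·-zeroʳ r)
D-·ˡ r f (x ⊕ y)   = ≈-trans (⊕-cong (D-·ˡ r f x) (D-·ˡ r f y)) (≈-sym (·-distˡ r _ _))
D-·ˡ r f (s · x)   = begin
  s · D (r · f) x       ≈⟨ ·-cong (D-·ˡ r f x) ⟩
  s · (r · D f x)       ≈⟨ ·-assoc s r _ ⟨
  (s ℚ.* r) · D f x     ≡⟨ cong (_· D f x) (ℚ.*-comm s r) ⟩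
  (r ℚ.* s) · D f x     ≈⟨ ·-assoc r s _ ⟩
  r · (s · D f x)       ∎
D-·ˡ r f ⟦ x , y ⟧ = begin
  ⟦ D (r · f) x , y ⟧ ⊕ ⟦ x , D (r · f) y ⟧  ≈⟨ ⊕-cong (br-cong (D-·ˡ r f x) ≈-refl) (br-cong ≈-refl (D-·ˡ r f y)) ⟩
  ⟦ r · D f x , y ⟧ ⊕ ⟦ x , r · D f y ⟧      ≈⟨ ⊕-cong (br-·ˡ r _ y) (br-·ʳ r x _) ⟩
  r · ⟦ D f x , y ⟧ ⊕ r · ⟦ x , D f y ⟧      ≈⟨ ·-distˡ r _ _ ⟨
  r · (⟦ D f x , y ⟧ ⊕ ⟦ x , D f y ⟧)        ∎

D-adaPow-b : ∀ f k → D f (adaPow k b) ≈ ⟦ f , adaPow k b ⟧ ⊕ ⊖ adaPow k ⟦ f , b ⟧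
D-adaPow-b f zero    = ≈-sym (⊕-invʳ ⟦ f , b ⟧)
D-adaPow-b f (suc k) = begin
  ⟦ ⟦ f , a ⟧ , x ⟧ ⊕ ⟦ a , D f x ⟧                 ≈⟨ ⊕-cong ≈-refl (br-cong ≈-refl (D-adaPow-b f k)) ⟩
  ⟦ ⟦ f , a ⟧ , x ⟧ ⊕ ⟦ a , ⟦ f , x ⟧ ⊕ ⊖ y ⟧       ≈⟨ ⊕-cong ≈-refl (br-⊕ʳ a _ _) ⟩
  ⟦ ⟦ f , a ⟧ , x ⟧ ⊕ (⟦ a , ⟦ f , x ⟧ ⟧ ⊕ ⟦ a , ⊖ y ⟧) ≈⟨ ⊕-assoc _ _ _ ⟨
  (⟦ ⟦ f , a ⟧ , x ⟧ ⊕ ⟦ a , ⟦ f , x ⟧ ⟧) ⊕ ⟦ a , ⊖ y ⟧ ≈⟨ ⊕-cong (≈-sym (br-leibniz f a x)) (br-·ʳ _ a y) ⟩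
  ⟦ f , ⟦ a , x ⟧ ⟧ ⊕ ⊖ ⟦ a , y ⟧                   ∎
  where
  x = adaPow k b
  y = adaPow k ⟦ f , b ⟧

D-adaPow-adaPow : ∀ u v → D (adaPow u b) (adaPow v b)
  ≈ ⊖ ΣL v (λ j → ℕ→ℚ (v C suc j) · ⟦ adaPow (suc j) (adaPow u b) , adaPow (v ∸ suc j) b ⟧)
D-adaPow-adaPow u v = begin
  D (adaPow u b) (adaPow v b)          ≈⟨ D-adaPow-b (adaPow u b) v ⟩
  T ⊕ ⊖ adaPow v ⟦ adaPow u b , b ⟧    ≈⟨ ⊕-cong ≈-refl (·-cong (≈-trans (adaPow-br v (adaPow u b) b) (ΣL-first v _))) ⟩
  T ⊕ ⊖ (1ℚ · T ⊕ S)                   ≈⟨ ⊕-cong ≈-refl (·-cong (⊕-cong (·-one T) ≈-refl)) ⟩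
  T ⊕ ⊖ (T ⊕ S)                        ≈⟨ ⊕-cong ≈-refl (·-distˡ _ T S) ⟩
  T ⊕ (⊖ T ⊕ ⊖ S)                      ≈⟨ ⊕-assoc _ _ _ ⟨
  (T ⊕ ⊖ T) ⊕ ⊖ S                      ≈⟨ ⊕-cong (⊕-invʳ T) ≈-refl ⟩
  𝟘 ⊕ ⊖ S                              ≈⟨ identityˡ (⊖ S) ⟩
  ⊖ S                                  ∎
  where
  T = ⟦ adaPow u b , adaPow v b ⟧
  S = ΣL v (λ j → ℕ→ℚ (v C suc j) · ⟦ adaPow (suc j) (adaPow u b) , adaPow (v ∸ suc j) b ⟧)

D-φ-φ : ∀ u v → D (φ (suc u)) (φ (suc v))
  ≈ ΣL v (λ j → (invFact v ℚ.* (invFact u ℚ.* (- 1ℚ ℚ.* ℕ→ℚ (v C suc j))))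
                · ⟦ adaPow (suc j) (adaPow u b) , adaPow (v ∸ suc j) b ⟧)
D-φ-φ u v = begin
  invFact v · D (invFact u · adaPow u b) (adaPow v b)     ≈⟨ ·-cong (D-·ˡ (invFact u) _ _) ⟩
  invFact v · (invFact u · D (adaPow u b) (adaPow v b))   ≈⟨ ·-cong (·-cong (D-adaPow-adaPow u v)) ⟩
  invFact v · (invFact u · ⊖ ΣL v (λ j → c j · X j))      ≈⟨ ·-cong (·-cong (·-ΣL-· v (- 1ℚ) c X)) ⟩
  invFact v · (invFact u · ΣL v (λ j → (- 1ℚ ℚ.* c j) · X j))
    ≈⟨ ·-cong (·-ΣL-· v (invFact u) _ X) ⟩
  invFact v · ΣL v (λ j → (invFact u ℚ.* (- 1ℚ ℚ.* c j)) · X j)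
    ≈⟨ ·-ΣL-· v (invFact v) _ X ⟩
  ΣL v (λ j → (invFact v ℚ.* (invFact u ℚ.* (- 1ℚ ℚ.* c j))) · X j)
    ∎
  where
  c : ℕ → ℚ
  c j = ℕ→ℚ (v C suc j)
  X : ℕ → L
  X j = ⟦ adaPow (suc j) (adaPow u b) , adaPow (v ∸ suc j) b ⟧

-- n = M + 2 and p = P + 1.  σ i j is the coefficient of E (i + j) in the i-th summand of the
-- first right-hand side, multiplied by −1/(n − 1).
module Expansion (M P : ℕ) where
  N p : ℕ
  N = suc M
  p = suc P

  κ : ℕ → ℚ
  κ i = ℕ→ℚ ((M + i) C M) ℚ.* bernoulli i

  E : ℕ → L
  E t = ⟦ adaPow (t + N) b , adaPow (P ∸ t) b ⟧

  σ : ℕ → ℕ → ℚ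
  σ i j = (- inv N) ℚ.* (κ i ℚ.* (invFact (p ∸ i) ℚ.* (invFact (M + i) ℚ.* (- 1ℚ ℚ.* ℕ→ℚ ((p ∸ i) C suc j)))))

  K : ℕ → ℚ
  K t = inv N ℚ.* (invFact M ℚ.* (invFact (P ∸ t) ℚ.* invFact (suc t)))

  term-expansion : ∀ i → i ≤ p →
    (- inv N) · (κ i · D (φ (N + i)) (φ (p + 1 ∸ i))) ≈ ΣL (p ∸ i) (λ j → σ i j · E (i + j))
  term-expansion i i≤p = begin
    (- inv N) · (κ i · D (φ (N + i)) (φ (p + 1 ∸ i)))
      ≡⟨ cong (λ v → (- inv N) · (κ i · D (φ (N + i)) (φ v))) p+1∸i≡1+[p∸i] ⟩
    (- inv N) · (κ i · D (φ (N + i)) (φ (suc (p ∸ i))))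
      ≈⟨ ·-cong (·-cong (D-φ-φ (M + i) (p ∸ i))) ⟩
    (- inv N) · (κ i · ΣL (p ∸ i) (λ j → s j · X j))
      ≈⟨ ·-cong (·-ΣL-· (p ∸ i) (κ i) s X) ⟩
    (- inv N) · ΣL (p ∸ i) (λ j → (κ i ℚ.* s j) · X j)
      ≈⟨ ·-ΣL-· (p ∸ i) (- inv N) _ X ⟩
    ΣL (p ∸ i) (λ j → σ i j · X j)
      ≈⟨ ΣL-cong (p ∸ i) (λ j _ → ·-cong (≡⇒≈ (X≡E j))) ⟩
    ΣL (p ∸ i) (λ j → σ i j · E (i + j))
      ∎
    where
    p+1∸i≡1+[p∸i] : p + 1 ∸ i ≡ suc (p ∸ i)
    p+1∸i≡1+[p∸i] = trans (cong (_∸ i) (ℕ.+-comm p 1)) (ℕ.+-∸-assoc 1 i≤p)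
    s : ℕ → ℚ
    s j = invFact (p ∸ i) ℚ.* (invFact (M + i) ℚ.* (- 1ℚ ℚ.* ℕ→ℚ ((p ∸ i) C suc j)))
    X : ℕ → L
    X j = ⟦ adaPow (suc j) (adaPow (M + i) b) , adaPow (p ∸ i ∸ suc j) b ⟧
    X≡E : ∀ j → X j ≡ E (i + j)
    X≡E j = cong₂ ⟦_,_⟧
      (trans (adaPow-+ (suc j) (M + i) b)
             (cong (λ m → adaPow m b) (solve 3 (λ j M i → con 1 :+ j :+ (M :+ i) := i :+ j :+ (con 1 :+ M)) refl j M i)))
      (cong (λ l → adaPow l b) (trans (ℕ.∸-+-assoc p i (suc j)) (cong (p ∸_) (ℕ.+-suc i j))))
      where open Data.Nat.Solver.+-*-Solver using (solve; _:=_; _:+_; con)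

  σ-antidiagonal : ∀ t i → i ≤ t → t ≤ P → σ i (t ∸ i) ≡ K t ℚ.* (ℕ→ℚ (suc t C i) ℚ.* bernoulli i)
  σ-antidiagonal t i i≤t t≤P =
    trans (cong (λ v → (- inv N) ℚ.* (κ i ℚ.* (invFact v ℚ.* (invFact (M + i) ℚ.* (- 1ℚ ℚ.* ℕ→ℚ (v C suc (t ∸ i)))))))
                (1+m∸n≡1+[o∸n]+[m∸o] i≤t t≤P))
    (trans (antidiagonal-coefficient M i (t ∸ i) (P ∸ t) (bernoulli i))
           (cong (λ s → (inv N ℚ.* (invFact M ℚ.* (invFact (P ∸ t) ℚ.* invFact (suc s)))) ℚ.* (ℕ→ℚ (suc s C i) ℚ.* bernoulli i))
                 (ℕ.m+[n∸m]≡n i≤t)))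

  G : ℕ → ℕ → L
  G i j = σ i j · E (i + j)

  antidiagonal : ℕ → L
  antidiagonal t = ΣL (suc t) (λ i → G i (t ∸ i))

  antidiagonal-sum : ∀ t → t ≤ P →
    antidiagonal t ≈ (K t ℚ.* Σℚ (suc t) (λ i → ℕ→ℚ (suc t C i) ℚ.* bernoulli i)) · E t
  antidiagonal-sum t t≤P = begin
    ΣL (suc t) (λ i → σ i (t ∸ i) · E (i + (t ∸ i)))
      ≈⟨ ΣL-cong (suc t) (λ i i<1+t → ≈-trans (·-congʳ _ (σ-antidiagonal t i (ℕ.≤-pred i<1+t) t≤P))
                                              (·-cong (≡⇒≈ (cong E (ℕ.m+[n∸m]≡n (ℕ.≤-pred i<1+t)))))) ⟩
    ΣL (suc t) (λ i → (K t ℚ.* (ℕ→ℚ (suc t C i) ℚ.* bernoulli i)) · E t)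
      ≈⟨ ΣL-·ˡ (suc t) _ (E t) ⟩
    Σℚ (suc t) (λ i → K t ℚ.* (ℕ→ℚ (suc t C i) ℚ.* bernoulli i)) · E t
      ≡⟨ cong (_· E t) (Σℚ-*ˡ (suc t) (K t) _) ⟩
    (K t ℚ.* Σℚ (suc t) (λ i → ℕ→ℚ (suc t C i) ℚ.* bernoulli i)) · E t
      ∎

  antidiagonal-vanishes : ∀ t → t < P → antidiagonal (suc t) ≈ 𝟘
  antidiagonal-vanishes t t<P = begin
    antidiagonal (suc t)
      ≈⟨ antidiagonal-sum (suc t) t<P ⟩
    (K (suc t) ℚ.* Σℚ (suc (suc t)) (λ i → ℕ→ℚ (suc (suc t) C i) ℚ.* bernoulli i)) · E (suc t)
      ≡⟨ cong (λ x → (K (suc t) ℚ.* x) · E (suc t)) (bernoulli-recurrence t) ⟩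
    (K (suc t) ℚ.* 0ℚ) · E (suc t)
      ≡⟨ cong (_· E (suc t)) (ℚ.*-zeroʳ (K (suc t))) ⟩
    0ℚ · E (suc t)
      ≈⟨ ·-zeroˡ (E (suc t)) ⟩
    𝟘 ∎

  antidiagonal-leading : antidiagonal 0 ≈ ⟦ φ (suc N) , φ p ⟧
  antidiagonal-leading = begin
    antidiagonal 0
      ≈⟨ antidiagonal-sum 0 z≤n ⟩
    (K 0 ℚ.* 1ℚ) · E 0
      ≡⟨ cong (_· E 0) (trans (ℚ.*-identityʳ (K 0)) (leading-coefficient M P)) ⟩
    (invFact N ℚ.* invFact P) · ⟦ adaPow N b , adaPow P b ⟧
      ≈⟨ br-·-· (invFact N) (invFact P) _ _ ⟨
    ⟦ φ (suc N) , φ p ⟧ ∎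

  part₁ : ⟦ φ (suc N) , φ p ⟧ ≈ (- inv N) · ΣL (p + 1) (λ i → κ i · D (φ (N + i)) (φ (p + 1 ∸ i)))
  part₁ = ≈-sym (begin
    (- inv N) · ΣL (p + 1) (λ i → κ i · D (φ (N + i)) (φ (p + 1 ∸ i)))
      ≈⟨ ·-ΣL (p + 1) (- inv N) _ ⟩
    ΣL (p + 1) (λ i → (- inv N) · (κ i · D (φ (N + i)) (φ (p + 1 ∸ i))))
      ≡⟨ cong (λ k → ΣL k (λ i → (- inv N) · (κ i · D (φ (N + i)) (φ (p + 1 ∸ i))))) (ℕ.+-comm p 1) ⟩
    ΣL (suc p) (λ i → (- inv N) · (κ i · D (φ (N + i)) (φ (p + 1 ∸ i))))
      ≈⟨ ΣL-cong (suc p) (λ i i<1+p → term-expansion i (ℕ.≤-pred i<1+p)) ⟩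
    ΣL (suc p) (λ i → ΣL (p ∸ i) (G i))
      ≈⟨ ΣL-triangle p G ⟩
    ΣL p antidiagonal
      ≈⟨ ΣL-first P antidiagonal ⟩
    antidiagonal 0 ⊕ ΣL P (λ t → antidiagonal (suc t))
      ≈⟨ ⊕-cong antidiagonal-leading (ΣL-zero P antidiagonal-vanishes) ⟩
    ⟦ φ (suc N) , φ p ⟧ ⊕ 𝟘
      ≈⟨ ⊕-idʳ _ ⟩
    ⟦ φ (suc N) , φ p ⟧
      ∎)

  part₂ : ⟦ φ (suc N) , φ p ⟧
    ≈ ⊖ ΣL (p + 1) (λ i → (ℕ→ℚ ((N + i) C N) ℚ.* (bernoulli i ℚ.* inv (N + i))) · D (φ (N + i)) (φ (p + 1 ∸ i)))
  part₂ = ≈-trans part₁ (begin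
    (- inv N) · ΣL (p + 1) (λ i → κ i · Dᵢ i)               ≈⟨ ·-ΣL-· (p + 1) (- inv N) κ Dᵢ ⟩
    ΣL (p + 1) (λ i → ((- inv N) ℚ.* κ i) · Dᵢ i)           ≈⟨ ΣL-cong (p + 1) (λ i _ → ·-congʳ (Dᵢ i) (sym (absorbed-coefficient M i (bernoulli i)))) ⟩
    ΣL (p + 1) (λ i → (- 1ℚ ℚ.* c i) · Dᵢ i)                ≈⟨ ·-ΣL-· (p + 1) (- 1ℚ) c Dᵢ ⟨
    ⊖ ΣL (p + 1) (λ i → c i · Dᵢ i)                         ∎)
    where
    Dᵢ : ℕ → L
    Dᵢ i = D (φ (N + i)) (φ (p + 1 ∸ i))
    c : ℕ → ℚ
    c i = ℕ→ℚ ((N + i) C N) ℚ.* (bernoulli i ℚ.* inv (N + i))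

mainTheorem4 : (n p : ℕ) → 2 ≤ n → 1 ≤ p →
    (⟦ φ n , φ p ⟧ ≈ (- inv (n ∸ 1)) · ΣL (p + 1) (λ i →
        (ℕ→ℚ ((n ∸ 2 + i) C (n ∸ 2)) * bernoulli i) · D (φ (n ∸ 1 + i)) (φ (p + 1 ∸ i))))
    × (⟦ φ n , φ p ⟧ ≈ ⊖ ΣL (p + 1) (λ i →
        (ℕ→ℚ ((n ∸ 1 + i) C (n ∸ 1)) * (bernoulli i * inv (n ∸ 1 + i))) · D (φ (n ∸ 1 + i)) (φ (p + 1 ∸ i))))
mainTheorem4 (suc (suc M)) (suc P) (s≤s (s≤s z≤n)) (s≤s z≤n) = part₁ , part₂
  where open Expansion M P
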